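{- Let $1\le k\le n$ and let $C=(\emptyset^{k-1},\{1,\dots,n\},\emptyset^{n-k})$ (the set $\{1,\dots,n\}$ in position $k$, all other sets empty). Then a permutation $w\in S_n$ is a $C$-permutation if and only if it has exactly $k-1$ descents.
   Context: A descent of $w=w_1\dots w_n$ is an index $i$ with $w_i>w_{i+1}$. A division of a totally ordered $S$ with $|S|=n$ is a sequence $C=(C_1,\dots,C_n)$ of pairwise disjoint (possibly empty) sets with union $S$ and $s<t$ whenever $s\in C_i,t\in C_j,i<j$. An element $s$ is admissible w.r.t. $C$ if it is the smallest element of $C_1$, the largest element of $C_n$, or lies in $C_i$ with $i\ne1,n$. For admissible $s\in C_i$, with $C_i^-=\{t\in C_i:t<s\}$, $C_i^+=\{t\in C_i:t>s\}$, the deletion $C^s$ is: if $i=1$, $(C_1^+\cup C_2,C_3,\dots,C_n)$; if $i\ne1,n$, $(C_1,\dots,C_{i-2},C_{i-1}\cup C_i^-,C_i^+\cup C_{i+1},C_{i+2},\dots,C_n)$; if $i=n$, $(C_1,\dots,C_{n-2},C_{n-1}\cup C_n^-)$. A $C$-permutation is an ordering $w_1\dots w_n$ of $S$ such that $w_1$ is admissible w.r.t. $C$, $w_2$ w.r.t. $C^{w_1}$, $w_3$ w.r.t. $(C^{w_1})^{w_2}$, and so on. -}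

module Defs where

open import Data.Nat using (ℕ; zero; suc; _∸_; _≤_; _<_; _<?_; _>?_; _+_)
open import Data.Fin using (Fin; toℕ)
open import Data.List using (List; []; _∷_; _++_; length; lookup; filter; map; upTo; replicate)
open import Data.List.Membership.Propositional using (_∈_)
open import Data.Product using (_×_)
open import Data.Sum using (_⊎_)
open import Relation.Binary.PropositionalEquality using (_≡_; _≢_)
open import Relation.Nullary.Decidable using (⌊_⌋)
open import Data.Bool using (if_then_else_)

-- A finite set of naturals is represented by a list (order / repetitions irrelevant);
-- a division C = (C_1,…,C_n) is a list of such blocks.
Block : Set
Block = List ℕ

Division : Set
Division = List Block

below above : ℕ → Block → Block
below s c = filter (λ t → t <? s) c
above s c = filter (λ t → s <? t) c

-- s is admissible w.r.t. C, lying in block number i (0-based index i, i.e. C_{i+1}):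
-- smallest element of C_1, or largest element of C_n, or in C_j with j ≠ 1, n.
Admissible : (C : Division) → Fin (length C) → ℕ → Set
Admissible C i s =
    (toℕ i ≡ 0 × (∀ {t} → t ∈ lookup C i → s ≤ t))
  ⊎ (toℕ i ≡ length C ∸ 1 × (∀ {t} → t ∈ lookup C i → t ≤ s))
  ⊎ (toℕ i ≢ 0 × toℕ i ≢ length C ∸ 1)

-- deletion C^s, where s lies in block with 0-based index i.
-- For a one-block division the result is the empty division.
del : Division → ℕ → ℕ → Division
del []                zero          s = []
del (c ∷ [])          zero          s = []
del (c₁ ∷ c₂ ∷ cs)    zero          s = (above s c₁ ++ c₂) ∷ cs
del []                (suc i)       s = []
del (c ∷ [])          (suc i)       s = []
del (c ∷ d ∷ [])      (suc zero)    s = (c ++ below s d) ∷ []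
del (c ∷ d ∷ e ∷ cs)  (suc zero)    s = (c ++ below s d) ∷ (above s d ++ e) ∷ cs
del (c ∷ d ∷ cs)      (suc (suc i)) s = c ∷ del (d ∷ cs) (suc i) s

data CPerm : Division → List ℕ → Set where
  done : CPerm [] []
  step : ∀ {C s w} (i : Fin (length C)) →
         s ∈ lookup C i → Admissible C i s →
         CPerm (del C (toℕ i) s) w → CPerm C (s ∷ w)

descentsFrom : ℕ → List ℕ → ℕ
descentsFrom x []       = 0
descentsFrom x (y ∷ ws) = (if ⌊ x >? y ⌋ then 1 else 0) + descentsFrom y ws

descents : List ℕ → ℕ
descents []       = 0
descents (x ∷ ws) = descentsFrom x ws

[1‥_] : ℕ → List ℕ
[1‥ n ] = map suc (upTo n)

singleBlock : ℕ → ℕ → Division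
singleBlock n k = replicate (k ∸ 1) [] ++ ([1‥ n ] ∷ replicate (n ∸ k) [])

-- Call C = (∅^a, A, B, ∅^b) a window, and let a pivot m separate its blocks: A < m ≤ B.
-- Deleting a letter s from C gives again a window, now separated by s: a letter of A leaves
-- (∅^(a-1), A<s, A>s ∪ B, ∅^b) and makes m > s a descent, a letter of B leaves
-- (∅^a, A ∪ B<s, B>s, ∅^(b-1)) and makes m ≤ s an ascent. Letters of inner blocks are always
-- admissible. When A is the first block only min A may be taken, which happens exactly when
-- no descent follows; when B is the last block only max B may be taken, which happens exactly
-- when all later letters descend. Hence, by induction, a listing u of A ∪ B is a
-- C-permutation iff m u has a + 1 descents. The division of the theorem is a window with an
-- empty neighbour, and a pivot above or below all of [n] turns this into k - 1 descents of w.

module Submission where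

open import Defs
open import Data.Nat using (ℕ; zero; suc; _+_; _∸_; _≤_; _<_; _<?_; _>?_; z≤n; s≤s; z<s)
open import Data.Nat.Properties
open import Data.Fin using (Fin; toℕ) renaming (zero to fzero; suc to fsuc)
open import Data.Fin.Properties using (toℕ-injective)
open import Data.List using (List; []; _∷_; _++_; length; lookup; replicate; upTo)
open import Data.List.Properties using (++-assoc; ++-identityʳ; length-map; length-upTo; length-replicate)
open import Data.List.Extrema.Nat using (max; xs≤max)
open import Data.List.Membership.Propositional using (_∈_; _∉_)
open import Data.List.Membership.Propositional.Properties
  using (∈-++⁺ˡ; ∈-++⁺ʳ; ∈-++⁻; ∈-filter⁺; ∈-filter⁻)
open import Data.List.Relation.Binary.Subset.Propositional using (_⊆_)
open import Data.List.Relation.Binary.Permutation.Propositional using (_↭_; ↭-sym; ↭⇒↭ₛ)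
open import Data.List.Relation.Binary.Permutation.Propositional.Properties using (∈-resp-↭; ↭-length)
open import Data.List.Relation.Binary.Permutation.Setoid.Properties using (Unique-resp-↭)
open import Data.List.Relation.Unary.All as All using (All; []; _∷_)
open import Data.List.Relation.Unary.All.Properties using (all-filter; anti-mono; ++⁺)
open import Data.List.Relation.Unary.AllPairs using (_∷_)
open import Data.List.Relation.Unary.Any using (here; there)
open import Data.List.Relation.Unary.Unique.Propositional using (Unique)
open import Data.List.Relation.Unary.Unique.Propositional.Properties using (map⁺; upTo⁺)
open import Data.Product using (Σ-syntax; _×_; _,_; proj₁; proj₂)
open import Data.Sum using (_⊎_; inj₁; inj₂; [_,_])
open import Function using (_∘_)
open import Function.Bundles using (_⇔_; mk⇔; Equivalence)
open import Function.Properties.Equivalence using () renaming (refl to ⇔-refl; trans to ⇔-trans; sym to ⇔-sym)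
open import Data.Product.Function.NonDependent.Propositional using (_×-⇔_)
open import Relation.Nullary using (yes; no; contradiction)
open import Relation.Binary.Definitions using (tri<; tri≈; tri>)
open import Relation.Binary.PropositionalEquality
  using (_≡_; _≢_; refl; sym; trans; cong; subst; setoid)

descentsFrom-∷-> : ∀ {x y} ws → y < x → descentsFrom x (y ∷ ws) ≡ suc (descentsFrom y ws)
descentsFrom-∷-> {x} {y} ws y<x with x >? y
... | yes _ = refl
... | no x≯y = contradiction y<x x≯y

descentsFrom-∷-≤ : ∀ {x y} ws → x ≤ y → descentsFrom x (y ∷ ws) ≡ descentsFrom y ws
descentsFrom-∷-≤ {x} {y} ws x≤y with x >? y
... | yes y<x = contradiction x≤y (<⇒≱ y<x)
... | no _ = refl

descentsFrom-≤ : ∀ {x} ws → All (x ≤_) ws → descentsFrom x ws ≡ descents ws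
descentsFrom-≤ []       _           = refl
descentsFrom-≤ (w ∷ ws) (x≤w ∷ _) = descentsFrom-∷-≤ ws x≤w

descentsFrom-> : ∀ {x} ws → 0 < length ws → All (_< x) ws → descentsFrom x ws ≡ suc (descents ws)
descentsFrom-> (w ∷ ws) _ (w<x ∷ _) = descentsFrom-∷-> ws w<x

descentsFrom≤length : ∀ x ws → descentsFrom x ws ≤ length ws
descentsFrom≤length x []       = z≤n
descentsFrom≤length x (y ∷ ws) with x >? y
... | yes _ = s≤s (descentsFrom≤length y ws)
... | no _  = m≤n⇒m≤1+n (descentsFrom≤length y ws)

descentsFrom≡0⇒≤ : ∀ {x} ws → descentsFrom x ws ≡ 0 → All (x ≤_) ws
descentsFrom≡0⇒≤ []       _ = []
descentsFrom≡0⇒≤ {x} (y ∷ ws) d with x >? y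
... | no x≯y = ≮⇒≥ x≯y ∷ All.map (≤-trans (≮⇒≥ x≯y)) (descentsFrom≡0⇒≤ ws d)

descentsFrom≡length⇒< : ∀ {x} ws → descentsFrom x ws ≡ length ws → All (_< x) ws
descentsFrom≡length⇒< []       _ = []
descentsFrom≡length⇒< {x} (y ∷ ws) d with x >? y
... | yes y<x = y<x ∷ All.map (λ z<y → <-trans z<y y<x) (descentsFrom≡length⇒< ws (suc-injective d))
... | no _    = contradiction (≤-trans (≤-reflexive (sym d)) (descentsFrom≤length y ws)) 1+n≰n

record Enumerates (u : List ℕ) (X : Block) : Set where
  field
    unique   : Unique u
    sound    : u ⊆ X
    complete : X ⊆ u

open Enumerates

infix 4 _≈_∖_

record _≈_∖_ (Y X : Block) (s : ℕ) : Set where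
  field
    ∖-sound    : Y ⊆ X
    ∖-fresh    : s ∉ Y
    ∖-complete : ∀ {t} → t ∈ X → t ≢ s → t ∈ Y

open _≈_∖_

enumerates-tail : ∀ {s u X Y} → Enumerates (s ∷ u) X → Y ≈ X ∖ s → Enumerates u Y
enumerates-tail {s} {u} {X} {Y} e Y≈X∖s with unique e
... | s≢u ∷ u! = record
  { unique   = u!
  ; sound    = λ t∈u → ∖-complete Y≈X∖s (sound e (there t∈u)) (λ { refl → All.lookup s≢u t∈u refl })
  ; complete = complete-tail
  }
  where
  complete-tail : Y ⊆ u
  complete-tail t∈Y with complete e (∖-sound Y≈X∖s t∈Y)
  ... | here refl = contradiction t∈Y (∖-fresh Y≈X∖s)
  ... | there t∈u = t∈u

∈-below : ∀ {s t} X → t ∈ below s X → t ∈ X × t < s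
∈-below {s} X = ∈-filter⁻ (_<? s) {xs = X}

∈-above : ∀ {s t} X → t ∈ above s X → t ∈ X × s < t
∈-above {s} X = ∈-filter⁻ (s <?_) {xs = X}

below++above≈∖ : ∀ s X → below s X ++ above s X ≈ X ∖ s
below++above≈∖ s X = record
  { ∖-sound    = λ t∈ → [ proj₁ ∘ ∈-below X , proj₁ ∘ ∈-above X ] (∈-++⁻ (below s X) t∈)
  ; ∖-fresh    = λ s∈ → [ n≮n s ∘ proj₂ ∘ ∈-below X , n≮n s ∘ proj₂ ∘ ∈-above X ]
                          (∈-++⁻ (below s X) s∈)
  ; ∖-complete = complete′
  }
  where
  complete′ : ∀ {t} → t ∈ X → t ≢ s → t ∈ below s X ++ above s X
  complete′ {t} t∈X t≢s with <-cmp t s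
  ... | tri< t<s _ _ = ∈-++⁺ˡ (∈-filter⁺ (_<? s) t∈X t<s)
  ... | tri≈ _ t≡s _ = contradiction t≡s t≢s
  ... | tri> _ _ s<t = ∈-++⁺ʳ (below s X) (∈-filter⁺ (s <?_) t∈X s<t)

above≈∖ : ∀ {s X} → All (s ≤_) X → above s X ≈ X ∖ s
above≈∖ {s} {X} s≤X = record
  { ∖-sound    = proj₁ ∘ ∈-above X
  ; ∖-fresh    = n≮n s ∘ proj₂ ∘ ∈-above X
  ; ∖-complete = λ t∈X t≢s → ∈-filter⁺ (s <?_) t∈X (≤∧≢⇒< (All.lookup s≤X t∈X) (t≢s ∘ sym))
  }

below≈∖ : ∀ {s X} → All (_≤ s) X → below s X ≈ X ∖ s
below≈∖ {s} {X} X≤s = record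
  { ∖-sound    = proj₁ ∘ ∈-below X
  ; ∖-fresh    = n≮n s ∘ proj₂ ∘ ∈-below X
  ; ∖-complete = λ t∈X t≢s → ∈-filter⁺ (_<? s) t∈X (≤∧≢⇒< (All.lookup X≤s t∈X) t≢s)
  }

≈∖-++ˡ : ∀ {s Y A} B → s ∉ B → Y ≈ A ∖ s → Y ++ B ≈ (A ++ B) ∖ s
≈∖-++ˡ {s} {Y} {A} B s∉B Y≈A∖s = record
  { ∖-sound    = λ t∈ → [ ∈-++⁺ˡ ∘ ∖-sound Y≈A∖s , ∈-++⁺ʳ A ] (∈-++⁻ Y t∈)
  ; ∖-fresh    = λ s∈ → [ ∖-fresh Y≈A∖s , s∉B ] (∈-++⁻ Y s∈)
  ; ∖-complete = λ t∈ t≢s → [ (λ t∈A → ∈-++⁺ˡ (∖-complete Y≈A∖s t∈A t≢s)) , ∈-++⁺ʳ Y ]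
                              (∈-++⁻ A t∈)
  }

≈∖-++ʳ : ∀ {s Y} A {B} → s ∉ A → Y ≈ B ∖ s → A ++ Y ≈ (A ++ B) ∖ s
≈∖-++ʳ {s} {Y} A {B} s∉A Y≈B∖s = record
  { ∖-sound    = λ t∈ → [ ∈-++⁺ˡ , ∈-++⁺ʳ A ∘ ∖-sound Y≈B∖s ] (∈-++⁻ A t∈)
  ; ∖-fresh    = λ s∈ → [ s∉A , ∖-fresh Y≈B∖s ] (∈-++⁻ A s∈)
  ; ∖-complete = λ t∈ t≢s → [ ∈-++⁺ˡ , (λ t∈B → ∈-++⁺ʳ A (∖-complete Y≈B∖s t∈B t≢s)) ]
                              (∈-++⁻ A t∈)
  }

admissible-interior : ∀ C {i s} → toℕ i ≢ 0 → toℕ i ≢ length C ∸ 1 → Admissible C i s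
admissible-interior C i≢0 i≢last = inj₂ (inj₂ (i≢0 , i≢last))

admissible-first⇔ : ∀ C {i s} → toℕ i ≡ 0 → toℕ i ≢ length C ∸ 1 →
                    Admissible C i s ⇔ All (s ≤_) (lookup C i)
admissible-first⇔ C {i} {s} i≡0 i≢last = mk⇔ first (λ s≤Cᵢ → inj₁ (i≡0 , All.lookup s≤Cᵢ))
  where
  first : Admissible C i s → All (s ≤_) (lookup C i)
  first (inj₁ (_ , s≤Cᵢ))           = All.tabulate s≤Cᵢ
  first (inj₂ (inj₁ (i≡last , _))) = contradiction i≡last i≢last
  first (inj₂ (inj₂ (i≢0 , _)))    = contradiction i≡0 i≢0

admissible-last⇔ : ∀ C {i s} → toℕ i ≡ length C ∸ 1 → toℕ i ≢ 0 →
                   Admissible C i s ⇔ All (_≤ s) (lookup C i)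
admissible-last⇔ C {i} {s} i≡last i≢0 = mk⇔ last (λ Cᵢ≤s → inj₂ (inj₁ (i≡last , All.lookup Cᵢ≤s)))
  where
  last : Admissible C i s → All (_≤ s) (lookup C i)
  last (inj₁ (i≡0 , _))           = contradiction i≡0 i≢0
  last (inj₂ (inj₁ (_ , Cᵢ≤s)))   = All.tabulate Cᵢ≤s
  last (inj₂ (inj₂ (_ , i≢last))) = contradiction i≡last i≢last

CPerm-∷⇔ : ∀ {C D s u k} (i : Fin (length C)) → toℕ i ≡ k → s ∈ lookup C i →
           (∀ j → s ∈ lookup C j → toℕ j ≡ k) → del C k s ≡ D →
           CPerm C (s ∷ u) ⇔ (Admissible C i s × CPerm D u)
CPerm-∷⇔ {C} {s = s} {u} i refl s∈Cᵢ only-i refl = mk⇔ invert (λ (adm , rest) → step i s∈Cᵢ adm rest)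
  where
  invert : CPerm C (s ∷ u) → Admissible C i s × CPerm (del C (toℕ i) s) u
  invert (step j s∈Cⱼ adm rest) with toℕ-injective (only-i j s∈Cⱼ)
  ... | refl = adm , rest

window : ℕ → Block → Block → ℕ → Division
window a A B b = replicate a [] ++ A ∷ B ∷ replicate b []

block : ℕ → Block → ℕ → Division
block a X b = replicate a [] ++ X ∷ replicate b []

length-window : ∀ a A B b → length (window a A B b) ≡ suc (suc (a + b))
length-window zero    A B b = cong (suc ∘ suc) (length-replicate b)
length-window (suc a) A B b = cong suc (length-window a A B b)

block-suc : ∀ a X → block (suc a) X 0 ≡ window a [] X 0
block-suc zero    X = refl
block-suc (suc a) X = cong ([] ∷_) (block-suc a X)

window-indexA : ∀ a {A B b} →
                Σ[ i ∈ Fin (length (window a A B b)) ] toℕ i ≡ a × lookup (window a A B b) i ≡ A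
window-indexA zero    = fzero , refl , refl
window-indexA (suc a) with window-indexA a
... | i , i≡a , Cᵢ≡A = fsuc i , cong suc i≡a , Cᵢ≡A

window-indexB : ∀ a {A B b} →
                Σ[ i ∈ Fin (length (window a A B b)) ] toℕ i ≡ suc a × lookup (window a A B b) i ≡ B
window-indexB zero    = fsuc fzero , refl , refl
window-indexB (suc a) with window-indexB a
... | i , i≡1+a , Cᵢ≡B = fsuc i , cong suc i≡1+a , Cᵢ≡B

∉-lookup-replicate-[] : ∀ b (j : Fin (length (replicate b []))) {s} →
                        s ∉ lookup (replicate {A = Block} b []) j
∉-lookup-replicate-[] (suc b) fzero    ()
∉-lookup-replicate-[] (suc b) (fsuc j) = ∉-lookup-replicate-[] b j

∈-lookup-window : ∀ a {A B b} (j : Fin (length (window a A B b))) {s} → s ∈ lookup (window a A B b) j →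
                  (toℕ j ≡ a × s ∈ A) ⊎ (toℕ j ≡ suc a × s ∈ B)
∈-lookup-window zero            fzero           s∈A = inj₁ (refl , s∈A)
∈-lookup-window zero            (fsuc fzero)    s∈B = inj₂ (refl , s∈B)
∈-lookup-window zero    {b = b} (fsuc (fsuc j)) s∈  = contradiction s∈ (∉-lookup-replicate-[] b j)
∈-lookup-window (suc a)         (fsuc j)        s∈ with ∈-lookup-window a j s∈
... | inj₁ (j≡a , s∈A)   = inj₁ (cong suc j≡a , s∈A)
... | inj₂ (j≡1+a , s∈B) = inj₂ (cong suc j≡1+a , s∈B)

window-index-of-A : ∀ a {A B b s} → s ∉ B → ∀ j → s ∈ lookup (window a A B b) j → toℕ j ≡ a
window-index-of-A a s∉B j s∈ with ∈-lookup-window a j s∈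
... | inj₁ (j≡a , _) = j≡a
... | inj₂ (_ , s∈B) = contradiction s∈B s∉B

window-index-of-B : ∀ a {A B b s} → s ∉ A → ∀ j → s ∈ lookup (window a A B b) j → toℕ j ≡ suc a
window-index-of-B a s∉A j s∈ with ∈-lookup-window a j s∈
... | inj₁ (_ , s∈A)   = contradiction s∈A s∉A
... | inj₂ (j≡1+a , _) = j≡1+a

-- del only recurses once it sees three leading blocks, hence the unfolded base cases.

del-window-A : ∀ a A B b s → del (window (suc a) A B b) (suc a) s ≡ window a (below s A) (above s A ++ B) b
del-window-A zero          A B b s = refl
del-window-A (suc zero)    A B b s = refl
del-window-A (suc (suc a)) A B b s = cong ([] ∷_) (del-window-A (suc a) A B b s)

del-window-B : ∀ a A B b s → del (window a A B (suc b)) (suc a) s ≡ window a (A ++ below s B) (above s B) b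
del-window-B a A B b s =
  trans (unfold a) (cong (λ B′ → window a (A ++ below s B) B′ b) (++-identityʳ (above s B)))
  where
  unfold : ∀ a → del (window a A B (suc b)) (suc a) s ≡ window a (A ++ below s B) (above s B ++ []) b
  unfold zero                = refl
  unfold (suc zero)          = refl
  unfold (suc (suc zero))    = refl
  unfold (suc (suc (suc a))) = cong ([] ∷_) (unfold (suc (suc a)))

del-window-last : ∀ a A B s → del (window a A B 0) (suc a) s ≡ block a (A ++ below s B) 0
del-window-last zero                A B s = refl
del-window-last (suc zero)          A B s = refl
del-window-last (suc (suc zero))    A B s = refl
del-window-last (suc (suc (suc a))) A B s = cong ([] ∷_) (del-window-last (suc (suc a)) A B s)

CPerm-window-∷-A⇔ : ∀ {a A B b s u} → s ∈ A → s ∉ B →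
                    CPerm (window (suc a) A B b) (s ∷ u) ⇔ CPerm (window a (below s A) (above s A ++ B) b) u
CPerm-window-∷-A⇔ {a} {A} {B} {b} {s} s∈A s∉B with window-indexA (suc a) {A} {B} {b}
... | i , i≡1+a , Cᵢ≡A =
  ⇔-trans (CPerm-∷⇔ i i≡1+a (subst (s ∈_) (sym Cᵢ≡A) s∈A) (window-index-of-A (suc a) s∉B)
                    (del-window-A a A B b s))
          (mk⇔ proj₂ (admissible-interior (window (suc a) A B b) i≢0 i≢last ,_))
  where
  i≢0 : toℕ i ≢ 0
  i≢0 = 1+n≢0 ∘ trans (sym i≡1+a)
  i≢last : toℕ i ≢ length (window (suc a) A B b) ∸ 1
  i≢last i≡last = m≢1+m+n a (suc-injective (trans (sym i≡1+a)
                                             (trans i≡last (cong (_∸ 1) (length-window (suc a) A B b)))))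

CPerm-window-∷-B⇔ : ∀ {a A B b s u} → s ∈ B → s ∉ A →
                    CPerm (window a A B (suc b)) (s ∷ u) ⇔ CPerm (window a (A ++ below s B) (above s B) b) u
CPerm-window-∷-B⇔ {a} {A} {B} {b} {s} s∈B s∉A with window-indexB a {A} {B} {suc b}
... | i , i≡1+a , Cᵢ≡B =
  ⇔-trans (CPerm-∷⇔ i i≡1+a (subst (s ∈_) (sym Cᵢ≡B) s∈B) (window-index-of-B a s∉A)
                    (del-window-B a A B b s))
          (mk⇔ proj₂ (admissible-interior (window a A B (suc b)) i≢0 i≢last ,_))
  where
  i≢0 : toℕ i ≢ 0
  i≢0 = 1+n≢0 ∘ trans (sym i≡1+a)
  i≢last : toℕ i ≢ length (window a A B (suc b)) ∸ 1
  i≢last i≡last = m+1+n≢m a (sym (suc-injective (trans (sym i≡1+a)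
                                                  (trans i≡last (cong (_∸ 1) (length-window a A B (suc b)))))))

CPerm-window-∷-A-first⇔ : ∀ {A B b s u} → s ∈ A → s ∉ B →
                          CPerm (window 0 A B b) (s ∷ u) ⇔ (All (s ≤_) A × CPerm (block 0 (above s A ++ B) b) u)
CPerm-window-∷-A-first⇔ {A} {B} {b} s∈A s∉B =
  ⇔-trans (CPerm-∷⇔ fzero refl s∈A (window-index-of-A 0 s∉B) refl)
          (admissible-first⇔ (window 0 A B b) refl 0≢last ×-⇔ ⇔-refl)
  where
  0≢last : 0 ≢ length (window 0 A B b) ∸ 1
  0≢last 0≡last = 0≢1+n (trans 0≡last (cong (_∸ 1) (length-window 0 A B b)))

CPerm-window-∷-B-last⇔ : ∀ {a A B s u} → s ∈ B → s ∉ A →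
                         CPerm (window a A B 0) (s ∷ u) ⇔ (All (_≤ s) B × CPerm (block a (A ++ below s B) 0) u)
CPerm-window-∷-B-last⇔ {a} {A} {B} {s} s∈B s∉A with window-indexB a {A} {B} {0}
... | i , i≡1+a , Cᵢ≡B =
  ⇔-trans (CPerm-∷⇔ i i≡1+a (subst (s ∈_) (sym Cᵢ≡B) s∈B) (window-index-of-B a s∉A)
                    (del-window-last a A B s))
          (subst (λ X → Admissible (window a A B 0) i s ⇔ All (_≤ s) X) Cᵢ≡B
                 (admissible-last⇔ (window a A B 0) i≡last i≢0)
           ×-⇔ ⇔-refl)
  where
  i≡last : toℕ i ≡ length (window a A B 0) ∸ 1
  i≡last = trans i≡1+a (sym (trans (cong (_∸ 1) (length-window a A B 0)) (cong suc (+-identityʳ a))))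
  i≢0 : toℕ i ≢ 0
  i≢0 = 1+n≢0 ∘ trans (sym i≡1+a)

suc-≡⇔ : ∀ {m n} → suc m ≡ suc n ⇔ m ≡ n
suc-≡⇔ = mk⇔ suc-injective (cong suc)

separated : ∀ {m A B s} → All (_< m) A → All (m ≤_) B → s ∈ A → s ∉ B
separated A<m m≤B s∈A s∈B = <⇒≱ (All.lookup A<m s∈A) (All.lookup m≤B s∈B)

s≤above-++ : ∀ {s m} A {B} → s < m → All (m ≤_) B → All (s ≤_) (above s A ++ B)
s≤above-++ {s} A s<m m≤B = ++⁺ (All.map <⇒≤ (all-filter (s <?_) A)) (All.map (≤-trans (<⇒≤ s<m)) m≤B)

++-below<s : ∀ {s m A} B → All (_< m) A → m ≤ s → All (_< s) (A ++ below s B)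
++-below<s {s} B A<m m≤s = ++⁺ (All.map (λ t<m → <-≤-trans t<m m≤s) A<m) (all-filter (_<? s) B)

mutual
  window-CPerm⇔ : ∀ a b {A B m} u → Enumerates u (A ++ B) → length u ≡ suc (suc (a + b)) →
                  All (_< m) A → All (m ≤_) B → CPerm (window a A B b) u ⇔ descentsFrom m u ≡ suc a
  window-CPerm⇔ a b     []      _ ()  _   _
  window-CPerm⇔ a b {A} (s ∷ u) e len A<m m≤B =
    window-CPerm⇔-∷ a b u e (suc-injective len) A<m m≤B (∈-++⁻ A (sound e (here refl)))

  window-CPerm⇔-∷ : ∀ a b {A B m s} u → Enumerates (s ∷ u) (A ++ B) → length u ≡ suc (a + b) →
                    All (_< m) A → All (m ≤_) B → s ∈ A ⊎ s ∈ B →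
                    CPerm (window a A B b) (s ∷ u) ⇔ descentsFrom m (s ∷ u) ≡ suc a
  window-CPerm⇔-∷ (suc a) b       u e len A<m m≤B (inj₁ s∈A) =
    window-CPerm⇔-∷A a b u e len A<m m≤B s∈A
  window-CPerm⇔-∷ zero    b       u e len A<m m≤B (inj₁ s∈A) =
    window-CPerm⇔-∷A-first b u e len A<m m≤B s∈A
  window-CPerm⇔-∷ a       (suc b) u e len A<m m≤B (inj₂ s∈B) =
    window-CPerm⇔-∷B a b u e (trans len (cong suc (+-suc a b))) A<m m≤B s∈B
  window-CPerm⇔-∷ a       zero    u e len A<m m≤B (inj₂ s∈B) =
    window-CPerm⇔-∷B-last a u e (trans len (cong suc (+-identityʳ a))) A<m m≤B s∈B

  window-CPerm⇔-∷A : ∀ a b {A B m s} u → Enumerates (s ∷ u) (A ++ B) → length u ≡ suc (suc (a + b)) →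
                     All (_< m) A → All (m ≤_) B → s ∈ A →
                     CPerm (window (suc a) A B b) (s ∷ u) ⇔ descentsFrom m (s ∷ u) ≡ suc (suc a)
  window-CPerm⇔-∷A a b {A} {B} {m} {s} u e len A<m m≤B s∈A =
    ⇔-trans (CPerm-window-∷-A⇔ s∈A s∉B)
            (⇔-trans (window-CPerm⇔ a b u e′ len (all-filter (_<? s) A) (s≤above-++ A s<m m≤B)) descent)
    where
    s<m = All.lookup A<m s∈A
    s∉B = separated A<m m≤B s∈A
    e′ : Enumerates u (below s A ++ above s A ++ B)
    e′ = enumerates-tail e (subst (_≈ A ++ B ∖ s) (++-assoc (below s A) (above s A) B)
                                  (≈∖-++ˡ B s∉B (below++above≈∖ s A)))
    descent : descentsFrom s u ≡ suc a ⇔ descentsFrom m (s ∷ u) ≡ suc (suc a)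
    descent rewrite descentsFrom-∷-> u s<m = ⇔-sym suc-≡⇔

  window-CPerm⇔-∷B : ∀ a b {A B m s} u → Enumerates (s ∷ u) (A ++ B) → length u ≡ suc (suc (a + b)) →
                     All (_< m) A → All (m ≤_) B → s ∈ B →
                     CPerm (window a A B (suc b)) (s ∷ u) ⇔ descentsFrom m (s ∷ u) ≡ suc a
  window-CPerm⇔-∷B a b {A} {B} {m} {s} u e len A<m m≤B s∈B =
    ⇔-trans (CPerm-window-∷-B⇔ s∈B s∉A)
            (⇔-trans (window-CPerm⇔ a b u e′ len (++-below<s B A<m m≤s)
                                    (All.map <⇒≤ (all-filter (s <?_) B)))
                     ascent)
    where
    m≤s = All.lookup m≤B s∈B
    s∉A = λ s∈A → separated A<m m≤B s∈A s∈B
    e′ : Enumerates u ((A ++ below s B) ++ above s B)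
    e′ = enumerates-tail e (subst (_≈ A ++ B ∖ s) (sym (++-assoc A (below s B) (above s B)))
                                  (≈∖-++ʳ A s∉A (below++above≈∖ s B)))
    ascent : descentsFrom s u ≡ suc a ⇔ descentsFrom m (s ∷ u) ≡ suc a
    ascent rewrite descentsFrom-∷-≤ u m≤s = ⇔-refl

  window-CPerm⇔-∷A-first : ∀ b {A B m s} u → Enumerates (s ∷ u) (A ++ B) → length u ≡ suc b →
                           All (_< m) A → All (m ≤_) B → s ∈ A →
                           CPerm (window 0 A B b) (s ∷ u) ⇔ descentsFrom m (s ∷ u) ≡ 1
  window-CPerm⇔-∷A-first b {A} {B} {m} {s} u e len A<m m≤B s∈A =
    ⇔-trans (CPerm-window-∷-A-first⇔ s∈A s∉B) (mk⇔ to from)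
    where
    s<m = All.lookup A<m s∈A
    s∉B = separated A<m m≤B s∈A
    e′ : All (s ≤_) A → Enumerates u (above s A ++ B)
    e′ s≤A = enumerates-tail e (≈∖-++ˡ B s∉B (above≈∖ s≤A))
    IH : All (s ≤_) A → CPerm (block 0 (above s A ++ B) b) u ⇔ descents u ≡ 0
    IH s≤A = block-CPerm⇔ 0 b u (e′ s≤A) len
    descents-s∷u : All (s ≤_) A → descentsFrom m (s ∷ u) ≡ suc (descents u)
    descents-s∷u s≤A = trans (descentsFrom-∷-> u s<m)
                             (cong suc (descentsFrom-≤ u (anti-mono (sound (e′ s≤A)) (s≤above-++ A s<m m≤B))))
    to : All (s ≤_) A × CPerm (block 0 (above s A ++ B) b) u → descentsFrom m (s ∷ u) ≡ 1
    to (s≤A , cp) = trans (descents-s∷u s≤A) (cong suc (Equivalence.to (IH s≤A) cp))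
    from : descentsFrom m (s ∷ u) ≡ 1 → All (s ≤_) A × CPerm (block 0 (above s A ++ B) b) u
    from d = s≤A , Equivalence.from (IH s≤A) (suc-injective (trans (sym (descents-s∷u s≤A)) d))
      where
      s≤u = descentsFrom≡0⇒≤ u (suc-injective (trans (sym (descentsFrom-∷-> u s<m)) d))
      s≤A = anti-mono (complete e ∘ ∈-++⁺ˡ) (≤-refl ∷ s≤u)

  window-CPerm⇔-∷B-last : ∀ a {A B m s} u → Enumerates (s ∷ u) (A ++ B) → length u ≡ suc a →
                          All (_< m) A → All (m ≤_) B → s ∈ B →
                          CPerm (window a A B 0) (s ∷ u) ⇔ descentsFrom m (s ∷ u) ≡ suc a
  window-CPerm⇔-∷B-last a {A} {B} {m} {s} u e len A<m m≤B s∈B =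
    ⇔-trans (CPerm-window-∷-B-last⇔ s∈B s∉A) (mk⇔ to from)
    where
    m≤s = All.lookup m≤B s∈B
    s∉A = λ s∈A → separated A<m m≤B s∈A s∈B
    e′ : All (_≤ s) B → Enumerates u (A ++ below s B)
    e′ B≤s = enumerates-tail e (≈∖-++ʳ A s∉A (below≈∖ B≤s))
    IH : All (_≤ s) B → CPerm (block a (A ++ below s B) 0) u ⇔ descents u ≡ a
    IH B≤s = block-CPerm⇔ a 0 u (e′ B≤s) (trans len (cong suc (sym (+-identityʳ a))))
    descents-s∷u : All (_≤ s) B → descentsFrom m (s ∷ u) ≡ suc (descents u)
    descents-s∷u B≤s = trans (descentsFrom-∷-≤ u m≤s)
                             (descentsFrom-> u (subst (0 <_) (sym len) z<s)
                                             (anti-mono (sound (e′ B≤s)) (++-below<s B A<m m≤s)))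
    to : All (_≤ s) B × CPerm (block a (A ++ below s B) 0) u → descentsFrom m (s ∷ u) ≡ suc a
    to (B≤s , cp) = trans (descents-s∷u B≤s) (cong suc (Equivalence.to (IH B≤s) cp))
    from : descentsFrom m (s ∷ u) ≡ suc a → All (_≤ s) B × CPerm (block a (A ++ below s B) 0) u
    from d = B≤s , Equivalence.from (IH B≤s) (suc-injective (trans (sym (descents-s∷u B≤s)) d))
      where
      u<s = descentsFrom≡length⇒< u (trans (trans (sym (descentsFrom-∷-≤ u m≤s)) d) (sym len))
      B≤s = anti-mono (complete e ∘ ∈-++⁺ʳ A) (≤-refl ∷ All.map <⇒≤ u<s)

  block-CPerm⇔ : ∀ a b {X} u → Enumerates u X → length u ≡ suc (a + b) →
                 CPerm (block a X b) u ⇔ descents u ≡ a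
  block-CPerm⇔ a (suc b) {X} u e len =
    ⇔-trans (window-CPerm⇔ a b u e′ (trans len (cong suc (+-suc a b))) X<pivot [])
            (subst (λ d → d ≡ suc a ⇔ descents u ≡ a)
                   (sym (descentsFrom-> u (subst (0 <_) (sym len) z<s) (anti-mono (sound e) X<pivot)))
                   suc-≡⇔)
    where
    e′ : Enumerates u (X ++ [])
    e′ = subst (Enumerates u) (sym (++-identityʳ X)) e
    X<pivot : All (_< suc (max 0 X)) X
    X<pivot = All.map s≤s (xs≤max 0 X)
  block-CPerm⇔ (suc a) zero {X} u e len =
    subst (λ D → CPerm D u ⇔ descents u ≡ suc a) (sym (block-suc a X))
          (subst (λ d → CPerm (window a [] X 0) u ⇔ d ≡ suc a)
                 (descentsFrom-≤ u (All.universal (λ _ → z≤n) u))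
                 (window-CPerm⇔ a 0 u e len [] (All.universal (λ _ → z≤n) X)))
  block-CPerm⇔ zero zero {X} (t ∷ []) e refl =
    mk⇔ (λ _ → refl) (λ _ → step fzero (sound e (here refl)) (inj₁ (refl , t≤X)) done)
    where
    t≤X : ∀ {x} → x ∈ X → t ≤ x
    t≤X x∈X with complete e x∈X
    ... | here refl = ≤-refl

↭⇒Enumerates : ∀ {u X} → Unique X → u ↭ X → Enumerates u X
↭⇒Enumerates X! u↭X = record
  { unique   = Unique-resp-↭ (setoid ℕ) (↭⇒↭ₛ (↭-sym u↭X)) X!
  ; sound    = ∈-resp-↭ u↭X
  ; complete = ∈-resp-↭ (↭-sym u↭X)
  }

unique-[1‥] : ∀ n → Unique [1‥ n ]
unique-[1‥] n = map⁺ suc-injective (upTo⁺ n)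

length-[1‥] : ∀ n → length [1‥ n ] ≡ n
length-[1‥] n = trans (length-map suc (upTo n)) (length-upTo n)

mainTheorem10 : (n k : ℕ) → 1 ≤ k → k ≤ n → (w : List ℕ) → w ↭ [1‥ n ] →
    (CPerm (singleBlock n k) w ⇔ descents w ≡ k ∸ 1)
mainTheorem10 n (suc k) _ k≤n w w↭[1‥n] =
  block-CPerm⇔ k (n ∸ suc k) w (↭⇒Enumerates (unique-[1‥] n) w↭[1‥n]) length-w
  where
  length-w : length w ≡ suc k + (n ∸ suc k)
  length-w = trans (↭-length w↭[1‥n]) (trans (length-[1‥] n) (sym (m+[n∸m]≡n k≤n)))
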